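{- Let $\rho=v_1,\dots,v_m$ be a play prefix, let $v_{m+1}$ be a vertex with $(v_m,v_{m+1})\in E$, let $\rho'=v_1,\dots,v_m,v_{m+1}$ and $d=\phi(v_{m+1})$. Let $\mathbf b=(b_k,\dots,b_0)$ be a colour witness for $\rho$. Suppose $d\in C^-$ is odd and, for all $j\le k$, either $b_j=\_$ or $b_j>d$. Then $\mathbf c=\mathbf b$ is a colour witness for $\rho'$.
   Context: A parity game has a finite directed graph $(V,E)$ in which every vertex has a successor and a colouring $\phi:V\to C$, where $C$ is a finite set of positive integers of the form $\{1,\dots,\max C\}$ or $\{2,\dots,\max C\}$; $C^-=C\setminus\{\max C\}$ if $\max C$ is odd and $C^-=C$ otherwise. A play prefix $\rho=v_1,\dots,v_m$ is a path in $(V,E)$; its positions are $1,\dots,m$. Let $\_$ be a blank symbol. $i$-colour witness. For $i\in C^-$ and $\ell\ge0$: if $i$ is even, an $i$-colour witness of length $\ell$ in $\rho$ is a sequence of positions $p_1<\dots<p_\ell$; if $i$ is odd it is $p_0<p_1<\dots<p_\ell$; positions lie in $\{1,\dots,m\}$ and: (evenness) $\phi(v_{p_j})$ is even for every index $j<\ell$ of the sequence, and $\phi(v_{p_\ell})=i$; (inner domination) for consecutive entries $p_j,p_{j+1}$, every $q$ with $p_j\le q\le p_{j+1}$ has $\phi(v_q)\le\max\{\phi(v_{p_j}),\phi(v_{p_{j+1}})\}$; (outer domination) $\phi(v_q)\le i$ for all $p_\ell\le q\le m$. Colour witness. A colour witness for $\rho$ is a sequence $\mathbf b=(b_k,\dots,b_0)$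 with entries in $C^-\cup\{\_\}$ such that, writing $\mathrm{pos}(i,\mathbf b)=\{j\le k:b_j=i\}$: (order) $b_i\ge b_j$ whenever $i>j$ and $b_i,b_j\ne\_$; (conciseness) for every odd $i\in C^-$, $|\mathrm{pos}(i,\mathbf b)|\le1$ and $b_0\ne i$; and there exist, for every colour $i$ with $\mathrm{pos}(i,\mathbf b)\ne\emptyset$, a number $\ell_i$ and an $i$-colour witness $W_i$ of length $\ell_i$ in $\rho$ such that (ordered witnesses) for colours $i>j$ both occurring in $\mathbf b$, the last position of $W_i$ is strictly smaller than the first position of $W_j$; and (length) for every $i\in C^-$, $\sum_{j\in U(i,\mathbf b)}\ell_j\ge\sum_{p\in P(i,\mathbf b)}2^p$, where $\mathrm{odd}(i,\mathbf b)=\inf\{j>i: j\text{ odd},\ \mathrm{pos}(j,\mathbf b)\ne\emptyset\}$ ($=\infty$ if no such $j$), $U(i,\mathbf b)=\{j: i\le j<\mathrm{odd}(i,\mathbf b),\ \mathrm{pos}(j,\mathbf b)\ne\emptyset\}$, and $P(i,\mathbf b)=\bigcup_{j\in U(i,\mathbf b)}\mathrm{pos}(j,\mathbf b)$. -}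

module Defs where

open import Data.Nat using (ℕ; zero; suc; _+_; _∸_; _^_; _≤_; _<_; _⊔_; _%_; _≡ᵇ_; _≤ᵇ_; _<ᵇ_; _≟_)
open import Data.Bool using (Bool; true; false; if_then_else_; _∧_; not; T)
open import Data.Maybe using (Maybe; just; nothing; fromMaybe)
open import Data.Maybe.Properties using (≡-dec)
open import Data.Fin using (Fin; toℕ)
open import Data.Fin.Properties using (any?)
open import Data.Nat.ListAction using (sum)
open import Data.List using (List; map; foldr; upTo; allFin; filterᵇ; head)
open import Data.Product using (Σ; ∃; _×_)
open import Data.Sum using (_⊎_)
open import Relation.Nullary using (¬_; does)
open import Relation.Binary.PropositionalEquality using (_≡_)

isEvenᵇ : ℕ → Bool
isEvenᵇ c = (c % 2) ≡ᵇ 0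

Even : ℕ → Set
Even c = T (isEvenᵇ c)

Odd : ℕ → Set
Odd c = T (not (isEvenᵇ c))

-- Parity games.  Vertices are Fin n.  The colour set C is
-- {lo, …, hi} with lo ∈ {1,2}; hi = max C.

record ParityGame : Set₁ where
  field
    n      : ℕ
    E      : Fin n → Fin n → Set
    total  : ∀ v → ∃ λ w → E v w
    lo hi  : ℕ
    lo-12  : lo ≡ 1 ⊎ lo ≡ 2
    lo≤hi  : lo ≤ hi
    φ      : Fin n → ℕ
    φ-in-C : ∀ v → lo ≤ φ v × φ v ≤ hi

open ParityGame public

InC : ParityGame → ℕ → Set
InC G c = lo G ≤ c × c ≤ hi G

InC⁻ : ParityGame → ℕ → Set
InC⁻ G c = InC G c × (Odd (hi G) → ¬ (c ≡ hi G))

-- Play prefixes ρ = v_1,…,v_m, represented by m and ρ : ℕ → V, where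
-- only the values at positions 1,…,m matter.

IsPlayPrefix : (G : ParityGame) → ℕ → (ℕ → Fin (n G)) → Set
IsPlayPrefix G m ρ =
  1 ≤ m × (∀ p → 1 ≤ p → p < m → E G (ρ p) (ρ (suc p)))

snoc : {A : Set} → (ℕ → A) → ℕ → A → ℕ → A
snoc ρ m v p = if p ≡ᵇ suc m then v else ρ p

-- The positions are P s, …, P ℓ where the start
-- index s is 1 for even i (p_1<…<p_ℓ) and 0 for odd i (p_0<…<p_ℓ).
-- If the sequence is empty (even i, ℓ = 0) the conditions on p_ℓ are vacuous.

start : ℕ → ℕ
start i = if isEvenᵇ i then 1 else 0

record IsColourWit (G : ParityGame) (m : ℕ) (ρ : ℕ → Fin (n G))
                   (i ℓ : ℕ) (P : ℕ → ℕ) : Set where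
  private
    col : ℕ → ℕ
    col q = φ G (ρ q)
    s = start i
  field
    i∈C⁻     : InC⁻ G i
    inRange  : ∀ j → s ≤ j → j ≤ ℓ → 1 ≤ P j × P j ≤ m
    increase : ∀ j → s ≤ j → j < ℓ → P j < P (suc j)
    evenness : ∀ j → s ≤ j → j < ℓ → Even (col (P j))
    lastCol  : s ≤ ℓ → col (P ℓ) ≡ i
    innerDom : ∀ j → s ≤ j → j < ℓ → ∀ q → P j ≤ q → q ≤ P (suc j) →
                 col q ≤ col (P j) ⊔ col (P (suc j))
    outerDom : s ≤ ℓ → ∀ q → P ℓ ≤ q → q ≤ m → col q ≤ i

-- Sequences b = (b_k,…,b_0) : Fin (suc k) → Maybe ℕ (nothing = blank _).

Occurs : {k : ℕ} → (Fin (suc k) → Maybe ℕ) → ℕ → Set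
Occurs b c = ∃ λ j → b j ≡ just c

occursᵇ : {k : ℕ} → (Fin (suc k) → Maybe ℕ) → ℕ → Bool
occursᵇ b c = does (any? (λ j → ≡-dec _≟_ (b j) (just c)))

-- largest entry (0 if all blank); all occurring colours are ≤ this
maxEntry : {k : ℕ} → (Fin (suc k) → Maybe ℕ) → ℕ
maxEntry {k} b = foldr _⊔_ 0 (map (λ j → fromMaybe 0 (b j)) (allFin (suc k)))

-- odd(i,b): least odd occurring colour > i (nothing = ∞)
oddAbove : {k : ℕ} → (Fin (suc k) → Maybe ℕ) → ℕ → Maybe ℕ
oddAbove b i =
  head (filterᵇ (λ j → not (isEvenᵇ j) ∧ occursᵇ b j)
                (map (λ t → suc i + t) (upTo (maxEntry b ∸ i))))

inUᵇ : {k : ℕ} → (Fin (suc k) → Maybe ℕ) → ℕ → ℕ → Bool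
inUᵇ b i j = (i ≤ᵇ j) ∧ occursᵇ b j ∧ below (oddAbove b i)
  where
    below : Maybe ℕ → Bool
    below nothing  = true
    below (just o) = j <ᵇ o

sumU : {k : ℕ} → (Fin (suc k) → Maybe ℕ) → (ℕ → ℕ) → ℕ → ℕ
sumU b ℓ i = sum (map (λ j → if inUᵇ b i j then ℓ j else 0) (upTo (suc (maxEntry b))))

sumP : {k : ℕ} → (Fin (suc k) → Maybe ℕ) → ℕ → ℕ
sumP {k} b i = sum (map term (allFin (suc k)))
  where
    term : Fin (suc k) → ℕ
    term p with b p
    ... | nothing = 0
    ... | just j  = if inUᵇ b i j then 2 ^ toℕ p else 0

record ColourWitness (G : ParityGame) (m : ℕ) (ρ : ℕ → Fin (n G))
                     (k : ℕ) (b : Fin (suc k) → Maybe ℕ) : Set where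
  field
    entries  : ∀ j c → b j ≡ just c → InC⁻ G c
    order    : ∀ i j ci cj → toℕ j < toℕ i → b i ≡ just ci → b j ≡ just cj → cj ≤ ci
    concise₁ : ∀ c → InC⁻ G c → Odd c → ∀ j j' → b j ≡ just c → b j' ≡ just c → j ≡ j'
    concise₂ : ∀ c → InC⁻ G c → Odd c → ¬ (b Fin.zero ≡ just c)
    ℓ        : ℕ → ℕ
    P        : ℕ → ℕ → ℕ
    wit      : ∀ c → Occurs b c → IsColourWit G m ρ c (ℓ c) (P c)
    ordered  : ∀ ci cj → Occurs b ci → Occurs b cj → cj < ci →
                 start ci ≤ ℓ ci → start cj ≤ ℓ cj →
                 P ci (ℓ ci) < P cj (start cj)
    lengthC  : ∀ i → InC⁻ G i → sumP b i ≤ sumU b ℓ i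

-- Every position of every colour witness W_c lies in 1,…,m, where ρ' agrees with ρ,
-- so all conditions except outer domination only look at the old prefix. Outer
-- domination gains the single position m+1, whose colour d is below every colour c
-- occurring in b.

module Submission where

open import Defs
open import Data.Nat using (ℕ; suc; _<_; _≤_; z≤n; s≤s; _⊔_; _≡ᵇ_)
open import Data.Nat.Properties using (≤-trans; ≤-refl; <⇒≤; m≤n⇒m≤1+n; m≤n⇒m<n∨m≡n)
open import Data.Fin using (Fin)
open import Data.Maybe using (Maybe; just; nothing)
open import Data.Maybe.Properties using (just-injective)
open import Data.Bool using (true; false)
open import Data.Product using (∃; _×_; _,_; proj₂)
open import Data.Sum using (_⊎_; inj₁; inj₂)
open import Relation.Binary.PropositionalEquality using (_≡_; refl; sym; cong; subst)

≡ᵇ-refl : ∀ p → (p ≡ᵇ p) ≡ true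
≡ᵇ-refl 0       = refl
≡ᵇ-refl (suc p) = ≡ᵇ-refl p

≡ᵇ-suc-false : ∀ {p m} → p ≤ m → (p ≡ᵇ suc m) ≡ false
≡ᵇ-suc-false z≤n       = refl
≡ᵇ-suc-false (s≤s p≤m) = ≡ᵇ-suc-false p≤m

module _ {A : Set} (ρ : ℕ → A) (m : ℕ) (v : A) where

  snoc-≤ : ∀ {p} → p ≤ m → snoc ρ m v p ≡ ρ p
  snoc-≤ {p} p≤m rewrite ≡ᵇ-suc-false p≤m = refl

  snoc-last : snoc ρ m v (suc m) ≡ v
  snoc-last rewrite ≡ᵇ-refl m = refl

IsColourWit-snoc : ∀ {G m ρ i ℓ P} (v : Fin (n G)) → φ G v ≤ i →
                   IsColourWit G m ρ i ℓ P → IsColourWit G (suc m) (snoc ρ m v) i ℓ P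
IsColourWit-snoc {G} {m} {ρ} {i} {ℓ} {P} v d≤i W = record
  { i∈C⁻     = i∈C⁻
  ; inRange  = λ j s≤j j≤ℓ → let (1≤Pj , Pj≤m) = inRange j s≤j j≤ℓ in 1≤Pj , m≤n⇒m≤1+n Pj≤m
  ; increase = increase
  ; evenness = evenness′
  ; lastCol  = lastCol′
  ; innerDom = innerDom′
  ; outerDom = outerDom′
  }
  where
  open IsColourWit W
  s = start i

  col′ : ℕ → ℕ
  col′ q = φ G (snoc ρ m v q)

  col′-≤ : ∀ {q} → q ≤ m → col′ q ≡ φ G (ρ q)
  col′-≤ q≤m = cong (φ G) (snoc-≤ ρ m v q≤m)

  P≤m : ∀ {j} → s ≤ j → j ≤ ℓ → P j ≤ m
  P≤m s≤j j≤ℓ = proj₂ (inRange _ s≤j j≤ℓ)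

  evenness′ : ∀ j → s ≤ j → j < ℓ → Even (col′ (P j))
  evenness′ j s≤j j<ℓ rewrite col′-≤ (P≤m s≤j (<⇒≤ j<ℓ)) = evenness j s≤j j<ℓ

  lastCol′ : s ≤ ℓ → col′ (P ℓ) ≡ i
  lastCol′ s≤ℓ rewrite col′-≤ (P≤m s≤ℓ ≤-refl) = lastCol s≤ℓ

  innerDom′ : ∀ j → s ≤ j → j < ℓ → ∀ q → P j ≤ q → q ≤ P (suc j) →
              col′ q ≤ col′ (P j) ⊔ col′ (P (suc j))
  innerDom′ j s≤j j<ℓ q Pj≤q q≤Pj+1 with P≤m (m≤n⇒m≤1+n s≤j) j<ℓ
  ... | Pj+1≤m
    rewrite col′-≤ (≤-trans q≤Pj+1 Pj+1≤m) | col′-≤ (P≤m s≤j (<⇒≤ j<ℓ)) | col′-≤ Pj+1≤m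
    = innerDom j s≤j j<ℓ q Pj≤q q≤Pj+1

  outerDom′ : s ≤ ℓ → ∀ q → P ℓ ≤ q → q ≤ suc m → col′ q ≤ i
  outerDom′ s≤ℓ q Pℓ≤q q≤m+1 with m≤n⇒m<n∨m≡n q≤m+1
  ... | inj₁ (s≤s q≤m) rewrite col′-≤ q≤m = outerDom s≤ℓ q Pℓ≤q q≤m
  ... | inj₂ refl      rewrite snoc-last ρ m v = d≤i

occurring-above : ∀ {k d} {b : Fin (suc k) → Maybe ℕ} →
                  (∀ j → b j ≡ nothing ⊎ ∃ λ c → b j ≡ just c × d < c) →
                  ∀ c → Occurs b c → d < c
occurring-above above c (j , bj≡c) with above j
... | inj₁ bj≡_ rewrite bj≡c with () ← bj≡_
... | inj₂ (c′ , bj≡c′ , d<c′) rewrite bj≡c = subst (_ <_) (sym (just-injective bj≡c′)) d<c′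

lemma7 : (G : ParityGame) (m : ℕ) (ρ : ℕ → Fin (n G)) → IsPlayPrefix G m ρ →
         (v : Fin (n G)) → E G (ρ m) v →
         (k : ℕ) (b : Fin (suc k) → Maybe ℕ) → ColourWitness G m ρ k b →
         InC⁻ G (φ G v) → Odd (φ G v) →
         (∀ j → b j ≡ nothing ⊎ ∃ λ c → b j ≡ just c × φ G v < c) →
         ColourWitness G (suc m) (snoc ρ m v) k b
lemma7 G m ρ _ v _ k b cw _ _ above = record
  { entries  = entries
  ; order    = order
  ; concise₁ = concise₁
  ; concise₂ = concise₂
  ; ℓ        = ℓ
  ; P        = P
  ; wit      = λ c oc → IsColourWit-snoc v (<⇒≤ (occurring-above above c oc)) (wit c oc)
  ; ordered  = ordered
  ; lengthC  = lengthC
  }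
  where open ColourWitness cw
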